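{- Let $G$ be a divisible design graph with parameters $(4n,n+2,n-2,2,4,n)$ whose canonical partition $V_1,V_2,V_3,V_4$ has quotient matrix $$\begin{pmatrix} 1&n-1&1&1\\ n-1&1&1&1\\ 1&1&1&n-1\\ 1&1&n-1&1\end{pmatrix},$$ let $G^\ast$ be the graph obtained from $G$ by complementing all adjacencies between $V_1$ and $V_2$ and all adjacencies between $V_3$ and $V_4$, let $D$ be a connected component of $G^\ast$, and put $D_i=D\cap V_i$. Call a pair $\{x,y\}$ of vertices a pair of type 2c if either $x\in V_1$, $y\in V_2$ and $x,y$ have no common neighbour in $G$ lying in $V_1\cup V_2$, or $x\in V_3$, $y\in V_4$ and $x,y$ have no common neighbour in $G$ lying in $V_3\cup V_4$. Then $D$ contains a pair of type 2c if and only if some four vertices of $D_1\cup D_2$, or some four vertices of $D_3\cup D_4$, induce a $4$-cycle in $G^\ast$. In this case the subgraphs of $G^\ast$ induced on $D_1\cup D_2$ and on $D_3\cup D_4$ are each isomorphic to a disjoint union of copies of $C_4$, and $D$ is isomorphic to $C_t[\overline{K_2}]$ for some $t$, where each copy of $\overline{K_2}$ is a pair of type 2c, and along the cycle the copies alternate: two consecutive copies lie in $V_1\cup V_2$, the next two lie in $V_3\cup V_4$, and so on.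
   Context: A divisible design graph (DDG) with parameters $(v,k,\lambda_1,\lambda_2,m,n)$ is a $k$-regular graph on $v=mn$ vertices whose vertex set can be partitioned into $m$ classes of size $n$ (a canonical partition) such that any two distinct vertices in the same class have exactly $\lambda_1$ common neighbours and any two vertices in different classes have exactly $\lambda_2$ common neighbours. The quotient matrix $(r_{ij})$ means every vertex of $V_i$ has exactly $r_{ij}$ neighbours in $V_j$. $C_t[\overline{K_2}]$ is the lexicographic product of the cycle $C_t$ with the edgeless graph on two vertices: each cycle vertex is replaced by two non-adjacent vertices, and vertices of copies corresponding to adjacent cycle vertices are adjacent. -}

module Defs where

open import Data.Nat using (ℕ; zero; suc; _+_; _∸_; _≡ᵇ_; _<ᵇ_; _%_; _≤_)
open import Data.Nat.Divisibility using (_∣_)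
open import Data.Bool using (Bool; true; false; _∧_; _∨_; not; if_then_else_)
open import Data.Fin using (Fin; toℕ) renaming (zero to f0; suc to fs)
open import Data.Product using (_×_; _,_; proj₁; proj₂; Σ; ∃)
open import Data.Sum using (_⊎_)
open import Relation.Binary.PropositionalEquality using (_≡_; _≢_)

-- Vertices of a graph on 4n vertices with the canonical partition
-- V_1,...,V_4 given by the first coordinate (class 0,1,2,3 = V_1,...,V_4).
Vtx : ℕ → Set
Vtx n = Fin 4 × Fin n

cls : ∀ {n} → Vtx n → Fin 4
cls = proj₁

Graph : ℕ → Set
Graph n = Vtx n → Vtx n → Bool

countFin : (k : ℕ) → (Fin k → Bool) → ℕ
countFin zero p = 0
countFin (suc k) p = (if p f0 then 1 else 0) + countFin k (λ i → p (fs i))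

sumFin : (k : ℕ) → (Fin k → ℕ) → ℕ
sumFin zero f = 0
sumFin (suc k) f = f f0 + sumFin k (λ i → f (fs i))

countV : ∀ {n} → (Vtx n → Bool) → ℕ
countV {n} p = sumFin 4 (λ i → countFin n (λ j → p (i , j)))

degree : ∀ {n} → Graph n → Vtx n → ℕ
degree adj u = countV (adj u)

common : ∀ {n} → Graph n → Vtx n → Vtx n → ℕ
common adj u v = countV (λ w → adj u w ∧ adj v w)

nbrsIn : ∀ {n} → Graph n → Vtx n → Fin 4 → ℕ
nbrsIn adj u j = countV (λ w → adj u w ∧ (toℕ (cls w) ≡ᵇ toℕ j))

-- Divisible design graph with parameters (4n, k, l1, l2, 4, n) whose
-- canonical partition is the partition into the classes {i} × Fin n.
record IsDDG (n k l1 l2 : ℕ) (adj : Graph n) : Set where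
  field
    symm      : ∀ u v → adj u v ≡ adj v u
    irrefl    : ∀ u → adj u u ≡ false
    regular   : ∀ u → degree adj u ≡ k
    sameClass : ∀ u v → cls u ≡ cls v → u ≢ v → common adj u v ≡ l1
    diffClass : ∀ u v → cls u ≢ cls v → common adj u v ≡ l2

quot : ℕ → Fin 4 → Fin 4 → ℕ
quot n f0 f0 = 1
quot n f0 (fs f0) = n ∸ 1
quot n f0 (fs (fs _)) = 1
quot n (fs f0) f0 = n ∸ 1
quot n (fs f0) (fs f0) = 1
quot n (fs f0) (fs (fs _)) = 1
quot n (fs (fs f0)) f0 = 1
quot n (fs (fs f0)) (fs f0) = 1
quot n (fs (fs f0)) (fs (fs f0)) = 1
quot n (fs (fs f0)) (fs (fs (fs f0))) = n ∸ 1
quot n (fs (fs (fs f0))) f0 = 1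
quot n (fs (fs (fs f0))) (fs f0) = 1
quot n (fs (fs (fs f0))) (fs (fs f0)) = n ∸ 1
quot n (fs (fs (fs f0))) (fs (fs (fs f0))) = 1

HasQuotient : ∀ {n} → Graph n → Set
HasQuotient {n} adj = ∀ u j → nbrsIn adj u j ≡ quot n (cls u) j

side : Fin 4 → Bool
side f0 = true
side (fs f0) = true
side (fs (fs _)) = false

in12 : ∀ {n} → Vtx n → Bool
in12 v = side (cls v)

in34 : ∀ {n} → Vtx n → Bool
in34 v = not (in12 v)

swapped : Fin 4 → Fin 4 → Bool
swapped f0 (fs f0) = true
swapped (fs f0) f0 = true
swapped (fs (fs f0)) (fs (fs (fs f0))) = true
swapped (fs (fs (fs f0))) (fs (fs f0)) = true
swapped _ _ = false

star : ∀ {n} → Graph n → Graph n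
star adj u v = if swapped (cls u) (cls v) then not (adj u v) else adj u v

data Walk {n} (adj : Graph n) : Vtx n → Vtx n → Set where
  here : ∀ {v} → Walk adj v v
  step : ∀ {u w v} → adj u w ≡ true → Walk adj w v → Walk adj u v

record IsComponent {n} (adj : Graph n) (D : Vtx n → Bool) : Set where
  field
    nonempty  : ∃ λ v → D v ≡ true
    closed    : ∀ u v → D u ≡ true → adj u v ≡ true → D v ≡ true
    connected : ∀ u v → D u ≡ true → D v ≡ true → Walk adj u v

Type2cOrd : ∀ {n} → Graph n → Vtx n → Vtx n → Set
Type2cOrd adj x y =
  (toℕ (cls x) ≡ 0 × toℕ (cls y) ≡ 1 ×
     (∀ w → in12 w ≡ true → adj x w ≡ true → adj y w ≡ false))
  ⊎
  (toℕ (cls x) ≡ 2 × toℕ (cls y) ≡ 3 ×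
     (∀ w → in34 w ≡ true → adj x w ≡ true → adj y w ≡ false))

Type2c : ∀ {n} → Graph n → Vtx n → Vtx n → Set
Type2c adj x y = Type2cOrd adj x y ⊎ Type2cOrd adj y x

HasInduced4Cycle : ∀ {n} → Graph n → (Vtx n → Bool) → Set
HasInduced4Cycle {n} E S =
  Σ (Vtx n) λ a → Σ (Vtx n) λ b → Σ (Vtx n) λ c → Σ (Vtx n) λ d →
    (S a ≡ true × S b ≡ true × S c ≡ true × S d ≡ true) ×
    (a ≢ b × a ≢ c × a ≢ d × b ≢ c × b ≢ d × c ≢ d) ×
    (E a b ≡ true × E b c ≡ true × E c d ≡ true × E d a ≡ true) ×
    (E a c ≡ false × E b d ≡ false)

isNext : ℕ → ℕ → ℕ → Bool
isNext t i j = (j ≡ᵇ suc i) ∨ ((suc i ≡ᵇ t) ∧ (j ≡ᵇ 0))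

cycAdj : ℕ → ℕ → ℕ → Bool
cycAdj t i j = isNext t i j ∨ isNext t j i

InducedIso : ∀ {n} {A : Set} → (A → A → Bool) → Graph n → (Vtx n → Bool) → (A → Vtx n) → Set
InducedIso {n} {A} EA E S f =
  (∀ p q → f p ≡ f q → p ≡ q) ×
  (∀ p → S (f p) ≡ true) ×
  (∀ v → S v ≡ true → ∃ λ p → f p ≡ v) ×
  (∀ p q → E (f p) (f q) ≡ EA p q)

unionC4 : ∀ {k} → Fin k × Fin 4 → Fin k × Fin 4 → Bool
unionC4 (i , a) (j , b) = (toℕ i ≡ᵇ toℕ j) ∧ cycAdj 4 (toℕ a) (toℕ b)

lexC : ∀ {t} → Fin t × Fin 2 → Fin t × Fin 2 → Bool
lexC {t} (i , _) (j , _) = cycAdj t (toℕ i) (toℕ j)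

IsUnionOfC4 : ∀ {n} → Graph n → (Vtx n → Bool) → Set
IsUnionOfC4 {n} E S = Σ ℕ λ k → Σ (Fin k × Fin 4 → Vtx n) λ f → InducedIso (unionC4 {k}) E S f

-- the subgraph of G* induced on D is isomorphic to C_t[K̄_2] for some t,
-- each copy of K̄_2 (i.e. {g(i,0), g(i,1)}) is a pair of type 2c (w.r.t. G),
-- and copies 0,1 lie in V_1∪V_2, copies 2,3 in V_3∪V_4, copies 4,5 in V_1∪V_2, ...
-- around the whole cycle (so 4 ∣ t).
IsAlternatingLex : ∀ {n} → Graph n → (Vtx n → Bool) → Set
IsAlternatingLex {n} adj D =
  Σ ℕ λ t → 3 ≤ t × 4 ∣ t × Σ (Fin t × Fin 2 → Vtx n) λ g →
    InducedIso (lexC {t}) (star adj) D g ×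
    (∀ i → Type2c adj (g (i , f0)) (g (i , fs f0))) ×
    (∀ i a → in12 (g (i , a)) ≡ (toℕ i % 4 <ᵇ 2))

-- In G*, by the quotient matrix, every vertex has exactly one neighbour in each class.
-- For u ∈ V₁ and v ∈ V₂ (or V₃, V₄), counting their λ₂ = 2 common G-neighbours class by
-- class shows that they share their G*-neighbours in V₁ and V₂ iff they share them in
-- V₃ and V₄.  So {u, v} has type 2c exactly when u and v are twins in G*; then u, v and
-- their G*-neighbours in their own classes form an induced 4-cycle, and conversely the
-- opposite corners of an induced 4-cycle on one side are twins.  Twinhood passes from a
-- twin pair to the pairs of its neighbours, so every vertex of the component has a twin.
-- Walking from a vertex of V₁ alternately to its neighbour in its own class and to its
-- neighbour in the opposite class gives a closed walk that visits V₁, V₁, V₃, V₃, ...;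
-- with the twins of its vertices it exhibits D as C_t[K̄₂], and each half of D as a
-- union of 4-cycles.
module Submission where

open import Defs
open import Data.Nat using (ℕ; zero; suc; _+_; _*_; _∸_; _≡ᵇ_; _<ᵇ_; _%_; _≤_; _<_; z≤n; s≤s)
import Data.Nat.Properties as ℕ
open import Data.Nat.DivMod using (_/_; [m+n]%n≡m%n; [m+kn]%n≡m%n; m<n⇒m%n≡m; m%n<n; m≡m%n+[m/n]*n)
open import Data.Nat.Divisibility using (divides)
open import Data.Bool using (Bool; true; false; _∧_; _∨_; not; _xor_; if_then_else_)
open import Data.Bool.Properties
  using (T-≡; not-involutive; not-injective; not-¬; ¬-not; not-distribˡ-xor; ∧-comm; ∧-identityʳ; ∧-zeroʳ;
         ∧-conicalˡ; ∧-conicalʳ; ∨-identityʳ; ∨-zeroʳ; ∧-distribˡ-∨)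
  renaming (_≟_ to _≟ᵇ_)
open import Data.Fin using (Fin; toℕ; fromℕ<) renaming (zero to f0; suc to fs)
open import Data.Fin.Properties using (_≟_; suc-injective; toℕ<n; toℕ-injective; toℕ-fromℕ<; pigeonhole)
open import Data.Product using (_×_; _,_; proj₁; proj₂; Σ; ∃)
open import Data.Product.Properties using (≡-dec; ×-≡,≡→≡)
open import Data.Sum using (_⊎_; inj₁; inj₂; [_,_])
open import Data.Empty using (⊥; ⊥-elim)
open import Function using (_∘_)
open import Function.Bundles using (_⇔_; mk⇔; Equivalence)
open import Relation.Binary.Definitions using (tri<; tri≈; tri>)
open import Relation.Binary.PropositionalEquality using (_≡_; _≢_; refl; sym; trans; cong; cong₂; subst; module ≡-Reasoning)
open import Relation.Nullary using (¬_; Dec; yes; no; does; contradiction)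
open import Relation.Nullary.Decidable using (dec-true)
open import Data.Nat.Tactic.RingSolver using (solve-∀)

true-iff⇒≡ : ∀ {a b} → (a ≡ true → b ≡ true) → (b ≡ true → a ≡ true) → a ≡ b
true-iff⇒≡ {true}  a⇒b _   = sym (a⇒b refl)
true-iff⇒≡ {false} {true} _ b⇒a = b⇒a refl
true-iff⇒≡ {false} {false} _ _ = refl

∨≡true⇒ : ∀ a b → a ∨ b ≡ true → a ≡ true ⊎ b ≡ true
∨≡true⇒ true  _ _ = inj₁ refl
∨≡true⇒ false _ p = inj₂ p

≡ᵇ⇒≡ : ∀ m n → (m ≡ᵇ n) ≡ true → m ≡ n
≡ᵇ⇒≡ m n p = ℕ.≡ᵇ⇒≡ m n (Equivalence.from T-≡ p)

≡⇒≡ᵇ : ∀ {m n} → m ≡ n → (m ≡ᵇ n) ≡ true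
≡⇒≡ᵇ {m} {n} eq = Equivalence.to T-≡ (ℕ.≡⇒≡ᵇ m n eq)

≡ᵇ-refl : ∀ m → (m ≡ᵇ m) ≡ true
≡ᵇ-refl m = ≡⇒≡ᵇ {m} refl

≢⇒≡ᵇ-false : ∀ m n → m ≢ n → (m ≡ᵇ n) ≡ false
≢⇒≡ᵇ-false m n m≢n = ¬-not (m≢n ∘ ≡ᵇ⇒≡ m n)

≡ᵇ-sym : ∀ m n → (m ≡ᵇ n) ≡ (n ≡ᵇ m)
≡ᵇ-sym zero    zero    = refl
≡ᵇ-sym zero    (suc n) = refl
≡ᵇ-sym (suc m) zero    = refl
≡ᵇ-sym (suc m) (suc n) = ≡ᵇ-sym m n

xor-injectiveʳ : ∀ a {x y} → a xor x ≡ a xor y → x ≡ y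
xor-injectiveʳ false e = e
xor-injectiveʳ true  e = not-injective e

right-unless : ∀ {A B : Set} → ¬ A → A ⊎ B → B
right-unless ¬a (inj₁ a) = ⊥-elim (¬a a)
right-unless _  (inj₂ b) = b

left-unless : ∀ {A B : Set} → ¬ B → A ⊎ B → A
left-unless _  (inj₁ a) = a
left-unless ¬b (inj₂ b) = ⊥-elim (¬b b)

least-witness : (P : ℕ → Set) → (∀ k → Dec (P k)) → ∀ d → P d →
  Σ ℕ λ m → P m × (∀ k → k < m → ¬ P k)
least-witness P P? zero    pd = 0 , pd , λ _ ()
least-witness P P? (suc d) pd with P? 0
... | yes p0 = 0 , p0 , λ _ ()
... | no ¬p0 with least-witness (P ∘ suc) (P? ∘ suc) d pd
...   | m , pm , below = suc m , pm , λ { zero _ → ¬p0 ; (suc k) (s≤s k<m) → below k k<m }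

bit : Bool → ℕ
bit b = if b then 1 else 0

countFin-cong : ∀ k {p q : Fin k → Bool} → (∀ i → p i ≡ q i) → countFin k p ≡ countFin k q
countFin-cong zero    _   = refl
countFin-cong (suc k) p≗q rewrite p≗q f0 = cong (_ +_) (countFin-cong k (p≗q ∘ fs))

countFin-false : ∀ k → countFin k (λ _ → false) ≡ 0
countFin-false zero    = refl
countFin-false (suc k) = countFin-false k

countFin-single : ∀ k (a : Fin k) (q : Fin k → Bool) →
  countFin k (λ i → does (i ≟ a) ∧ q i) ≡ bit (q a)
countFin-single (suc k) f0 q with q f0
... | true  = cong suc (countFin-false k)
... | false = countFin-false k
countFin-single (suc k) (fs a) q = countFin-single k a (q ∘ fs)

countFin-not : ∀ k (p : Fin k → Bool) → countFin k (not ∘ p) + countFin k p ≡ k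
countFin-not zero    p = refl
countFin-not (suc k) p with p f0
... | true  = trans (ℕ.+-suc _ _) (cong suc (countFin-not k (p ∘ fs)))
... | false = cong suc (countFin-not k (p ∘ fs))

countFin≡0⇒false : ∀ k (p : Fin k → Bool) → countFin k p ≡ 0 → ∀ i → p i ≡ false
countFin≡0⇒false (suc k) p c≡0 f0 with p f0 | c≡0
... | false | _ = refl
countFin≡0⇒false (suc k) p c≡0 (fs i) with p f0 | c≡0
... | false | c≡0′ = countFin≡0⇒false k (p ∘ fs) c≡0′ i

countFin≡1⇒unique : ∀ k (p : Fin k → Bool) → countFin k p ≡ 1 →
  Σ (Fin k) λ a → p a ≡ true × (∀ i → p i ≡ true → i ≡ a)
countFin≡1⇒unique (suc k) p c≡1 with p f0 in p₀
... | true = f0 , p₀ , λ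
  { f0     _  → refl
  ; (fs i) pi → contradiction (trans (sym pi) (countFin≡0⇒false k (p ∘ fs) (ℕ.suc-injective c≡1) i)) λ () }
... | false with countFin≡1⇒unique k (p ∘ fs) c≡1
... | a , pa , unique = fs a , pa , λ
  { f0     pi → contradiction (trans (sym pi) p₀) λ ()
  ; (fs i) pi → cong fs (unique i pi) }

does≡true⇒ : ∀ {k} {a b : Fin k} → does (a ≟ b) ≡ true → a ≡ b
does≡true⇒ {a = a} {b} p with a ≟ b
... | yes a≡b = a≡b
... | no  _   = contradiction p λ ()

≟-does-sym : ∀ {k} (a b : Fin k) → does (a ≟ b) ≡ does (b ≟ a)
≟-does-sym a b = true-iff⇒≡ (λ p → dec-true (b ≟ a) (sym (does≡true⇒ p)))
                             (λ p → dec-true (a ≟ b) (sym (does≡true⇒ p)))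

countFin-xor-pair : ∀ k s s′ (a b : Fin k) → s ∧ s′ ≡ false →
  countFin k (λ i → (s xor does (i ≟ a)) ∧ (s′ xor does (i ≟ b))) ≡ bit ((s xor s′) xor does (a ≟ b))
countFin-xor-pair k false false a b _ = countFin-single k a (λ i → does (i ≟ b))
countFin-xor-pair k false true  a b _ = countFin-single k a (λ i → not (does (i ≟ b)))
countFin-xor-pair k true  false a b _ =
  trans (countFin-cong k (λ i → ∧-comm (not (does (i ≟ a))) _))
        (trans (countFin-single k b (λ i → not (does (i ≟ a)))) (cong (bit ∘ not) (≟-does-sym b a)))

bits-balance : ∀ a b c d → bit (not a) + (bit (not b) + (bit c + (bit d + 0))) ≡ 2 → a ∧ b ≡ c ∧ d
bits-balance true  true  true  true  _  = refl
bits-balance true  true  true  false ()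
bits-balance true  true  false true  ()
bits-balance true  true  false false ()
bits-balance true  false true  true  ()
bits-balance true  false true  false _  = refl
bits-balance true  false false _     _  = refl
bits-balance false true  true  true  ()
bits-balance false true  true  false _  = refl
bits-balance false true  false _     _  = refl
bits-balance false false true  true  ()
bits-balance false false true  false ()
bits-balance false false false true  ()
bits-balance false false false false _  = refl

+-rotate₂ : ∀ x y z w → x + (y + (z + (w + 0))) ≡ z + (w + (x + (y + 0)))
+-rotate₂ = solve-∀

sumFin-cong : ∀ k {f g : Fin k → ℕ} → (∀ i → f i ≡ g i) → sumFin k f ≡ sumFin k g
sumFin-cong zero    _   = refl
sumFin-cong (suc k) f≗g = cong₂ _+_ (f≗g f0) (sumFin-cong k (f≗g ∘ fs))

sumFin-zero : ∀ k (f : Fin k → ℕ) → (∀ i → f i ≡ 0) → sumFin k f ≡ 0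
sumFin-zero zero    f _   = refl
sumFin-zero (suc k) f f≡0 rewrite f≡0 f0 = sumFin-zero k (f ∘ fs) (f≡0 ∘ fs)

sumFin-single : ∀ k (f : Fin k → ℕ) j → (∀ i → i ≢ j → f i ≡ 0) → sumFin k f ≡ f j
sumFin-single (suc k) f f0 off =
  trans (cong (f f0 +_) (sumFin-zero k (f ∘ fs) (λ i → off (fs i) λ ()))) (ℕ.+-identityʳ _)
sumFin-single (suc k) f (fs j) off rewrite off f0 λ () =
  sumFin-single k (f ∘ fs) j (λ i i≢j → off (fs i) (i≢j ∘ suc-injective))

countV-inClass : ∀ {n} (p : Vtx n → Bool) j →
  countV (λ w → p w ∧ (toℕ (cls w) ≡ᵇ toℕ j)) ≡ countFin n (λ k → p (j , k))
countV-inClass {n} p j = trans (sumFin-single 4 _ j elsewhere) (countFin-cong n λ k →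
  trans (cong (p (j , k) ∧_) (≡ᵇ-refl (toℕ j))) (∧-identityʳ _))
  where
  elsewhere : ∀ i → i ≢ j → countFin n (λ k → p (i , k) ∧ (toℕ i ≡ᵇ toℕ j)) ≡ 0
  elsewhere i i≢j = trans (countFin-cong n λ k →
    trans (cong (p (i , k) ∧_) (≢⇒≡ᵇ-false _ _ (i≢j ∘ toℕ-injective))) (∧-zeroʳ _)) (countFin-false n)

pattern V₁ = f0
pattern V₂ = fs f0
pattern V₃ = fs (fs f0)
pattern V₄ = fs (fs (fs f0))

partner : Fin 4 → Fin 4
partner V₁ = V₂
partner V₂ = V₁
partner V₃ = V₄
partner V₄ = V₃

opposite : Fin 4 → Fin 4
opposite V₁ = V₃
opposite V₂ = V₄
opposite V₃ = V₁
opposite V₄ = V₂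

data Leading : Fin 4 → Set where
  V₁-leading : Leading V₁
  V₃-leading : Leading V₃

partner-involutive : ∀ c → partner (partner c) ≡ c
partner-involutive V₁ = refl
partner-involutive V₂ = refl
partner-involutive V₃ = refl
partner-involutive V₄ = refl

opposite-involutive : ∀ c → opposite (opposite c) ≡ c
opposite-involutive V₁ = refl
opposite-involutive V₂ = refl
opposite-involutive V₃ = refl
opposite-involutive V₄ = refl

partner-≢ : ∀ c → partner c ≢ c
partner-≢ V₁ ()
partner-≢ V₂ ()
partner-≢ V₃ ()
partner-≢ V₄ ()

opposite-≢ : ∀ c → opposite c ≢ c
opposite-≢ V₁ ()
opposite-≢ V₂ ()
opposite-≢ V₃ ()
opposite-≢ V₄ ()

side-partner : ∀ c → side (partner c) ≡ side c
side-partner V₁ = refl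
side-partner V₂ = refl
side-partner V₃ = refl
side-partner V₄ = refl

side≡⇒same-or-partner : ∀ c d → side d ≡ side c → d ≡ c ⊎ d ≡ partner c
side≡⇒same-or-partner V₁ V₁ _ = inj₁ refl
side≡⇒same-or-partner V₁ V₂ _ = inj₂ refl
side≡⇒same-or-partner V₂ V₁ _ = inj₂ refl
side≡⇒same-or-partner V₂ V₂ _ = inj₁ refl
side≡⇒same-or-partner V₃ V₃ _ = inj₁ refl
side≡⇒same-or-partner V₃ V₄ _ = inj₂ refl
side≡⇒same-or-partner V₄ V₃ _ = inj₂ refl
side≡⇒same-or-partner V₄ V₄ _ = inj₁ refl
side≡⇒same-or-partner V₁ V₃ ()
side≡⇒same-or-partner V₁ V₄ ()
side≡⇒same-or-partner V₂ V₃ ()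
side≡⇒same-or-partner V₂ V₄ ()
side≡⇒same-or-partner V₃ V₁ ()
side≡⇒same-or-partner V₃ V₂ ()
side≡⇒same-or-partner V₄ V₁ ()
side≡⇒same-or-partner V₄ V₂ ()

leading-or-partner : ∀ c → Leading c ⊎ Leading (partner c)
leading-or-partner V₁ = inj₁ V₁-leading
leading-or-partner V₂ = inj₂ V₁-leading
leading-or-partner V₃ = inj₁ V₃-leading
leading-or-partner V₄ = inj₂ V₃-leading

stepClass : Bool → Fin 4 → Fin 4
stepClass b c = if b then c else opposite c

stepClass-involutive : ∀ b c → stepClass b (stepClass b c) ≡ c
stepClass-involutive true  c = refl
stepClass-involutive false c = opposite-involutive c

leading-stepClass : ∀ b {c} → Leading c → Leading (stepClass b c)
leading-stepClass true  l          = l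
leading-stepClass false V₁-leading = V₃-leading
leading-stepClass false V₃-leading = V₁-leading

partner-not-leading : ∀ {c} → Leading c → ¬ Leading (partner c)
partner-not-leading V₁-leading ()
partner-not-leading V₃-leading ()

leading-same-or-opposite : ∀ {c d} → Leading c → Leading d → d ≡ c ⊎ d ≡ opposite c
leading-same-or-opposite V₁-leading V₁-leading = inj₁ refl
leading-same-or-opposite V₁-leading V₃-leading = inj₂ refl
leading-same-or-opposite V₃-leading V₁-leading = inj₂ refl
leading-same-or-opposite V₃-leading V₃-leading = inj₁ refl

leading⇒stepClass : ∀ {c d} → Leading c → Leading d → Σ Bool λ b → d ≡ stepClass b c
leading⇒stepClass lc ld with leading-same-or-opposite lc ld
... | inj₁ d≡c   = true , d≡c
... | inj₂ d≡c′  = false , d≡c′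

swapped-sym : ∀ c d → swapped c d ≡ swapped d c
swapped-sym V₁ V₁ = refl
swapped-sym V₁ V₂ = refl
swapped-sym V₁ V₃ = refl
swapped-sym V₁ V₄ = refl
swapped-sym V₂ V₁ = refl
swapped-sym V₂ V₂ = refl
swapped-sym V₂ V₃ = refl
swapped-sym V₂ V₄ = refl
swapped-sym V₃ V₁ = refl
swapped-sym V₃ V₂ = refl
swapped-sym V₃ V₃ = refl
swapped-sym V₃ V₄ = refl
swapped-sym V₄ V₁ = refl
swapped-sym V₄ V₂ = refl
swapped-sym V₄ V₃ = refl
swapped-sym V₄ V₄ = refl

swapped-partner : ∀ c → swapped c (partner c) ≡ true
swapped-partner V₁ = refl
swapped-partner V₂ = refl
swapped-partner V₃ = refl
swapped-partner V₄ = refl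

swapped-irrefl : ∀ c → swapped c c ≡ false
swapped-irrefl V₁ = refl
swapped-irrefl V₂ = refl
swapped-irrefl V₃ = refl
swapped-irrefl V₄ = refl

quot≡ : ∀ n c d → quot n c d ≡ (if swapped c d then n ∸ 1 else 1)
quot≡ n V₁ V₁ = refl
quot≡ n V₁ V₂ = refl
quot≡ n V₁ (fs (fs _)) = refl
quot≡ n V₂ V₁ = refl
quot≡ n V₂ V₂ = refl
quot≡ n V₂ (fs (fs _)) = refl
quot≡ n V₃ V₁ = refl
quot≡ n V₃ V₂ = refl
quot≡ n V₃ V₃ = refl
quot≡ n V₃ V₄ = refl
quot≡ n V₄ V₁ = refl
quot≡ n V₄ V₂ = refl
quot≡ n V₄ V₃ = refl
quot≡ n V₄ V₄ = refl

mateStep : ℕ → Bool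
mateStep zero          = true
mateStep (suc zero)    = false
mateStep (suc (suc i)) = mateStep i

walkClass : ℕ → Fin 4
walkClass 0 = V₁
walkClass 1 = V₁
walkClass 2 = V₃
walkClass 3 = V₃
walkClass (suc (suc (suc (suc i)))) = walkClass i

mateStep-suc : ∀ i → mateStep (suc i) ≡ not (mateStep i)
mateStep-suc zero          = refl
mateStep-suc (suc zero)    = refl
mateStep-suc (suc (suc i)) = mateStep-suc i

walkClass-suc : ∀ i → walkClass (suc i) ≡ stepClass (mateStep i) (walkClass i)
walkClass-suc 0 = refl
walkClass-suc 1 = refl
walkClass-suc 2 = refl
walkClass-suc 3 = refl
walkClass-suc (suc (suc (suc (suc i)))) = walkClass-suc i

mateStep-+4k : ∀ k i → mateStep (k * 4 + i) ≡ mateStep i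
mateStep-+4k zero    i = refl
mateStep-+4k (suc k) i = mateStep-+4k k i

walkClass-+4k : ∀ k i → walkClass (k * 4 + i) ≡ walkClass i
walkClass-+4k zero    i = refl
walkClass-+4k (suc k) i = walkClass-+4k k i

mateStep-4k : ∀ k → mateStep (k * 4) ≡ true
mateStep-4k zero    = refl
mateStep-4k (suc k) = mateStep-4k k

walkClass-4k : ∀ k → walkClass (k * 4) ≡ V₁
walkClass-4k zero    = refl
walkClass-4k (suc k) = walkClass-4k k

walkClass-leading : ∀ i → Leading (walkClass i)
walkClass-leading 0 = V₁-leading
walkClass-leading 1 = V₁-leading
walkClass-leading 2 = V₃-leading
walkClass-leading 3 = V₃-leading
walkClass-leading (suc (suc (suc (suc i)))) = walkClass-leading i

walkClass≡V₁⇒4k : ∀ d → walkClass d ≡ V₁ → mateStep d ≡ true → Σ ℕ λ k → d ≡ k * 4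
walkClass≡V₁⇒4k 0 _ _ = 0 , refl
walkClass≡V₁⇒4k (suc (suc (suc (suc d)))) c m with walkClass≡V₁⇒4k d c m
... | k , d≡4k = suc k , cong (λ i → suc (suc (suc (suc i)))) d≡4k

side-walkClass : ∀ i → side (walkClass i) ≡ (i % 4 <ᵇ 2)
side-walkClass 0 = refl
side-walkClass 1 = refl
side-walkClass 2 = refl
side-walkClass 3 = refl
side-walkClass (suc (suc (suc (suc i)))) =
  trans (side-walkClass i) (cong (_<ᵇ 2) (sym (trans (cong (_% 4) (ℕ.+-comm 4 i)) ([m+n]%n≡m%n i 4))))

block-unique : ∀ q q′ x y → x < 4 → y < 4 → q * 4 + x ≡ q′ * 4 + y → q ≡ q′ × x ≡ y
block-unique q q′ x y x<4 y<4 eq = q≡q′ , x≡y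
  where
  remainder : ∀ q x → x < 4 → (q * 4 + x) % 4 ≡ x
  remainder q x x<4 = trans (cong (_% 4) (ℕ.+-comm (q * 4) x)) (trans ([m+kn]%n≡m%n x q 4) (m<n⇒m%n≡m x<4))
  x≡y : x ≡ y
  x≡y = trans (sym (remainder q x x<4)) (trans (cong (_% 4) eq) (remainder q′ y y<4))
  q≡q′ : q ≡ q′
  q≡q′ = ℕ.*-cancelʳ-≡ q q′ 4 (ℕ.+-cancelʳ-≡ x (q * 4) (q′ * 4) (trans eq (cong (q′ * 4 +_) (sym x≡y))))

block-decompose : ∀ j → Σ ℕ λ q → Σ ℕ λ r → r < 4 × j ≡ q * 4 + r
block-decompose j = j / 4 , j % 4 , m%n<n j 4 , trans (m≡m%n+[m/n]*n j 4) (ℕ.+-comm (j % 4) (j / 4 * 4))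

block-< : ∀ {q M x} → q < M → x < 4 → q * 4 + x < M * 4
block-< {q} {M} q<M x<4 =
  ℕ.<-≤-trans (ℕ.+-monoʳ-< (q * 4) x<4) (subst (_≤ M * 4) (ℕ.+-comm 4 (q * 4)) (ℕ.*-monoˡ-≤ 4 q<M))

isNext-blocks : ∀ M q q′ x y → x < 4 → y < 4 → ¬ (x ≡ 3 × y ≡ 0) →
  isNext (M * 4) (q * 4 + x) (q′ * 4 + y) ≡ (q ≡ᵇ q′) ∧ (y ≡ᵇ suc x)
isNext-blocks M q q′ x y x<4 y<4 not-wrap =
  trans (cong₂ _∨_ successor no-wrap) (∨-identityʳ _)
  where
  shift : q * 4 + suc x ≡ suc (q * 4 + x)
  shift = ℕ.+-suc (q * 4) x
  successor : (q′ * 4 + y ≡ᵇ suc (q * 4 + x)) ≡ (q ≡ᵇ q′) ∧ (y ≡ᵇ suc x)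
  successor = true-iff⇒≡ fwd bwd
    where
    fwd : (q′ * 4 + y ≡ᵇ suc (q * 4 + x)) ≡ true → (q ≡ᵇ q′) ∧ (y ≡ᵇ suc x) ≡ true
    fwd p with ℕ.m≤n⇒m<n∨m≡n x<4
    ... | inj₁ sx<4 with block-unique q′ q y (suc x) y<4 sx<4 (trans (≡ᵇ⇒≡ _ _ p) (sym shift))
    ...   | refl , refl = cong₂ _∧_ (≡ᵇ-refl q) (≡ᵇ-refl y)
    fwd p | inj₂ refl = ⊥-elim (not-wrap (refl , proj₂ (block-unique q′ (suc q) y 0 y<4 (s≤s z≤n)
              (trans (≡ᵇ⇒≡ _ _ p) (trans (cong suc (ℕ.+-comm (q * 4) 3)) (sym (ℕ.+-identityʳ _)))))))
    bwd : (q ≡ᵇ q′) ∧ (y ≡ᵇ suc x) ≡ true → (q′ * 4 + y ≡ᵇ suc (q * 4 + x)) ≡ true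
    bwd p with ≡ᵇ⇒≡ q q′ (∧-conicalˡ _ _ p) | ≡ᵇ⇒≡ y (suc x) (∧-conicalʳ _ _ p)
    ... | refl | refl = ≡⇒≡ᵇ shift
  no-wrap : (suc (q * 4 + x) ≡ᵇ M * 4) ∧ (q′ * 4 + y ≡ᵇ 0) ≡ false
  no-wrap = ¬-not λ p →
    wraps (≡ᵇ⇒≡ _ _ (∧-conicalˡ _ _ p)) (ℕ.m+n≡0⇒n≡0 (q′ * 4) (≡ᵇ⇒≡ _ _ (∧-conicalʳ _ _ p)))
    where
    wraps : suc (q * 4 + x) ≡ M * 4 → y ≡ 0 → ⊥
    wraps last y≡0 with ℕ.m≤n⇒m<n∨m≡n x<4
    ... | inj₁ sx<4 = ℕ.0≢1+n (sym (proj₂ (block-unique q M (suc x) 0 sx<4 (s≤s z≤n)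
                        (trans shift (trans last (sym (ℕ.+-identityʳ _)))))))
    ... | inj₂ refl = not-wrap (refl , y≡0)

cycAdj-blocks : ∀ M q q′ x y → x < 4 → y < 4 → ¬ (x ≡ 3 × y ≡ 0) → ¬ (y ≡ 3 × x ≡ 0) →
  cycAdj (M * 4) (q * 4 + x) (q′ * 4 + y) ≡ (q ≡ᵇ q′) ∧ ((y ≡ᵇ suc x) ∨ (x ≡ᵇ suc y))
cycAdj-blocks M q q′ x y x<4 y<4 xy yx =
  trans (cong₂ _∨_ (isNext-blocks M q q′ x y x<4 y<4 xy)
                   (trans (isNext-blocks M q′ q y x y<4 x<4 yx) (cong (_∧ (x ≡ᵇ suc y)) (≡ᵇ-sym q′ q))))
        (sym (∧-distribˡ-∨ (q ≡ᵇ q′) _ _))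

-- inHalf false selects V₁ ∪ V₂ and inHalf true selects V₃ ∪ V₄.
inHalf : Bool → Fin 4 → Bool
inHalf far c = far xor side c

halfPos : Bool → Fin 2 → ℕ
halfPos false ρ = toℕ ρ
halfPos true  ρ = 2 + toℕ ρ

halfPos<4 : ∀ far ρ → halfPos far ρ < 4
halfPos<4 false f0      = s≤s z≤n
halfPos<4 false (fs f0) = s≤s (s≤s z≤n)
halfPos<4 true  f0      = s≤s (s≤s (s≤s z≤n))
halfPos<4 true  (fs f0) = s≤s (s≤s (s≤s (s≤s z≤n)))

halfPos-injective : ∀ far {ρ ρ′} → halfPos far ρ ≡ halfPos far ρ′ → ρ ≡ ρ′
halfPos-injective false e = toℕ-injective e
halfPos-injective true  e = toℕ-injective (ℕ.suc-injective (ℕ.suc-injective e))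

halfPos-no-wrap : ∀ far ρ ρ′ → ¬ (halfPos far ρ ≡ 3 × halfPos far ρ′ ≡ 0)
halfPos-no-wrap false f0      _       (() , _)
halfPos-no-wrap false (fs f0) _       (() , _)
halfPos-no-wrap true  _       f0      (_ , ())
halfPos-no-wrap true  _       (fs f0) (_ , ())

halfPos-inHalf : ∀ far ρ → inHalf far (walkClass (halfPos far ρ)) ≡ true
halfPos-inHalf false f0      = refl
halfPos-inHalf false (fs f0) = refl
halfPos-inHalf true  f0      = refl
halfPos-inHalf true  (fs f0) = refl

inHalf⇒halfPos : ∀ far r → r < 4 → inHalf far (walkClass r) ≡ true → Σ (Fin 2) λ ρ → halfPos far ρ ≡ r
inHalf⇒halfPos false 0 _ _ = f0 , refl
inHalf⇒halfPos false 1 _ _ = fs f0 , refl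
inHalf⇒halfPos true  2 _ _ = f0 , refl
inHalf⇒halfPos true  3 _ _ = fs f0 , refl
inHalf⇒halfPos false 2 _ ()
inHalf⇒halfPos false 3 _ ()
inHalf⇒halfPos true  0 _ ()
inHalf⇒halfPos true  1 _ ()
inHalf⇒halfPos _ (suc (suc (suc (suc _)))) (s≤s (s≤s (s≤s (s≤s ())))) _

-- Vertex a of C₄ is copy c4Copy a of position c4Row a in a half-block of the walk,
-- so the cycle runs through (0, 0), (1, 0), (0, 1), (1, 1).
c4Row c4Copy : Fin 4 → Fin 2
c4Row V₁ = f0
c4Row V₂ = fs f0
c4Row V₃ = f0
c4Row V₄ = fs f0
c4Copy V₁ = f0
c4Copy V₂ = f0
c4Copy V₃ = fs f0
c4Copy V₄ = fs f0

c4Vertex : Fin 2 → Fin 2 → Fin 4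
c4Vertex f0      f0      = V₁
c4Vertex (fs f0) f0      = V₂
c4Vertex f0      (fs f0) = V₃
c4Vertex (fs f0) (fs f0) = V₄

c4Vertex-row-copy : ∀ a → c4Vertex (c4Row a) (c4Copy a) ≡ a
c4Vertex-row-copy V₁ = refl
c4Vertex-row-copy V₂ = refl
c4Vertex-row-copy V₃ = refl
c4Vertex-row-copy V₄ = refl

c4Row-vertex : ∀ ρ κ → c4Row (c4Vertex ρ κ) ≡ ρ
c4Row-vertex f0      f0      = refl
c4Row-vertex (fs f0) f0      = refl
c4Row-vertex f0      (fs f0) = refl
c4Row-vertex (fs f0) (fs f0) = refl

c4Copy-vertex : ∀ ρ κ → c4Copy (c4Vertex ρ κ) ≡ κ
c4Copy-vertex f0      f0      = refl
c4Copy-vertex (fs f0) f0      = refl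
c4Copy-vertex f0      (fs f0) = refl
c4Copy-vertex (fs f0) (fs f0) = refl

c4-adjacent : ∀ a a′ → let r = toℕ (c4Row a) ; r′ = toℕ (c4Row a′) in
  (r′ ≡ᵇ suc r) ∨ (r ≡ᵇ suc r′) ≡ cycAdj 4 (toℕ a) (toℕ a′)
c4-adjacent V₁ V₁ = refl
c4-adjacent V₁ V₂ = refl
c4-adjacent V₁ V₃ = refl
c4-adjacent V₁ V₄ = refl
c4-adjacent V₂ V₁ = refl
c4-adjacent V₂ V₂ = refl
c4-adjacent V₂ V₃ = refl
c4-adjacent V₂ V₄ = refl
c4-adjacent V₃ V₁ = refl
c4-adjacent V₃ V₂ = refl
c4-adjacent V₃ V₃ = refl
c4-adjacent V₃ V₄ = refl
c4-adjacent V₄ V₁ = refl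
c4-adjacent V₄ V₂ = refl
c4-adjacent V₄ V₃ = refl
c4-adjacent V₄ V₄ = refl

c4-halfPos-adjacent : ∀ far a a′ → let p = halfPos far (c4Row a) ; p′ = halfPos far (c4Row a′) in
  (p′ ≡ᵇ suc p) ∨ (p ≡ᵇ suc p′) ≡ cycAdj 4 (toℕ a) (toℕ a′)
c4-halfPos-adjacent false = c4-adjacent
c4-halfPos-adjacent true  = c4-adjacent

module StarGraph {n : ℕ} {adj : Graph n} (ddg : IsDDG n (n + 2) (n ∸ 2) 2 adj) (hq : HasQuotient adj) where
  open IsDDG ddg

  G* : Graph n
  G* = star adj

  G*-sym : ∀ u v → G* u v ≡ G* v u
  G*-sym u v rewrite swapped-sym (cls u) (cls v) | symm u v = refl

  G*-irrefl : ∀ u → G* u u ≡ false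
  G*-irrefl u rewrite swapped-irrefl (cls u) = irrefl u

  adj-count : ∀ u c → countFin n (λ k → adj u (c , k)) ≡ (if swapped (cls u) c then n ∸ 1 else 1)
  adj-count u c = trans (sym (countV-inClass (adj u) c)) (trans (hq u c) (quot≡ n (cls u) c))

  -- Between swapped classes u has n − 1 G-neighbours, hence exactly one G*-neighbour.
  star-count : ∀ u c → countFin n (λ k → G* u (c , k)) ≡ 1
  star-count u c with swapped (cls u) c | adj-count u c
  ... | false | one = one
  ... | true  | n-1 = ℕ.+-cancelʳ-≡ _ _ 1 (trans (countFin-not n _) (sym (trans (cong suc n-1) (ℕ.m+[n∸m]≡n 1≤n))))
    where
    1≤n : 1 ≤ n
    1≤n = ℕ.≤-trans (s≤s z≤n) (toℕ<n (proj₂ u))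

  abstract
    nbIdx : Vtx n → Fin 4 → Fin n
    nbIdx u c = proj₁ (countFin≡1⇒unique n _ (star-count u c))

    nbIdx-adjacent : ∀ u c → G* u (c , nbIdx u c) ≡ true
    nbIdx-adjacent u c = proj₁ (proj₂ (countFin≡1⇒unique n _ (star-count u c)))

    nbIdx-unique : ∀ u c k → G* u (c , k) ≡ true → k ≡ nbIdx u c
    nbIdx-unique u c = proj₂ (proj₂ (countFin≡1⇒unique n _ (star-count u c)))

  nb : Vtx n → Fin 4 → Vtx n
  nb u c = c , nbIdx u c

  nb-adjacent : ∀ u c → G* u (nb u c) ≡ true
  nb-adjacent = nbIdx-adjacent

  nb-unique : ∀ u v → G* u v ≡ true → v ≡ nb u (cls v)
  nb-unique u (c , k) uv = cong (c ,_) (nbIdx-unique u c k uv)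

  nb-back : ∀ u v → G* u v ≡ true → nb v (cls u) ≡ u
  nb-back u v uv = sym (nb-unique v u (trans (G*-sym v u) uv))

  nb-nb : ∀ u c → nb (nb u c) (cls u) ≡ u
  nb-nb u c = nb-back u (nb u c) (nb-adjacent u c)

  G*-point : ∀ u c k → G* u (c , k) ≡ does (k ≟ nbIdx u c)
  G*-point u c k with k ≟ nbIdx u c
  ... | yes refl = nb-adjacent u c
  ... | no  k≢ = ¬-not λ uv → k≢ (cong proj₂ (nb-unique u (c , k) uv))

  adj-point : ∀ u c k → adj u (c , k) ≡ swapped (cls u) c xor does (k ≟ nbIdx u c)
  adj-point u c k = trans (unflip (swapped (cls u) c) (adj u (c , k))) (cong (swapped (cls u) c xor_) (G*-point u c k))
    where
    unflip : ∀ s a → a ≡ s xor (if s then not a else a)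
    unflip true  a = sym (not-involutive a)
    unflip false a = refl

  shares : Vtx n → Vtx n → Fin 4 → Bool
  shares u v c = does (nbIdx u c ≟ nbIdx v c)

  common≡ : ∀ u v → (∀ c → swapped (cls u) c ∧ swapped (cls v) c ≡ false) →
    common adj u v ≡ sumFin 4 (λ c → bit ((swapped (cls u) c xor swapped (cls v) c) xor shares u v c))
  common≡ u v not-both = sumFin-cong 4 λ c →
    trans (countFin-cong n λ k → cong₂ _∧_ (adj-point u c k) (adj-point v c k))
          (countFin-xor-pair n (swapped (cls u) c) (swapped (cls v) c) (nbIdx u c) (nbIdx v c) (not-both c))

  Partners : Vtx n → Vtx n → Set
  Partners u v = Leading (cls u) × cls v ≡ partner (cls u)

  -- u and v have (1 − s₁) + (1 − s₂) + s₃ + s₄ = λ₂ common G-neighbours, where sᵢ says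
  -- whether their G*-neighbours in Vᵢ coincide (for V₃, V₄ the roles of the sides swap).
  partners-balance : ∀ {u v} → Partners u v →
    shares u v (cls u) ∧ shares u v (cls v) ≡ shares u v (opposite (cls u)) ∧ shares u v (partner (opposite (cls u)))
  partners-balance {V₁ , a} {V₂ , b} (V₁-leading , refl) =
    bits-balance (s V₁) (s V₂) (s V₃) (s V₄)
      (trans (sym (common≡ (V₁ , a) (V₂ , b) λ { V₁ → refl ; V₂ → refl ; V₃ → refl ; V₄ → refl }))
             (diffClass (V₁ , a) (V₂ , b) λ ()))
    where
    s : Fin 4 → Bool
    s = shares (V₁ , a) (V₂ , b)
  partners-balance {V₃ , a} {V₄ , b} (V₃-leading , refl) =
    bits-balance (s V₃) (s V₄) (s V₁) (s V₂)
      (trans (+-rotate₂ (bit (not (s V₃))) (bit (not (s V₄))) (bit (s V₁)) (bit (s V₂)))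
      (trans (sym (common≡ (V₃ , a) (V₄ , b) λ { V₁ → refl ; V₂ → refl ; V₃ → refl ; V₄ → refl }))
             (diffClass (V₃ , a) (V₄ , b) λ ())))
    where
    s : Fin 4 → Bool
    s = shares (V₃ , a) (V₄ , b)

  Twins : Vtx n → Vtx n → Set
  Twins u v = ∀ c → nbIdx u c ≡ nbIdx v c

  twins-nb : ∀ {u v} → Twins u v → ∀ c → nb u c ≡ nb v c
  twins-nb t c = cong (c ,_) (t c)

  twins-G* : ∀ {u v} → Twins u v → ∀ w → G* u w ≡ G* v w
  twins-G* {u} {v} t (c , k) = trans (G*-point u c k) (trans (cong (λ i → does (k ≟ i)) (t c)) (sym (G*-point v c k)))

  twins-G*′ : ∀ {u v} → Twins u v → ∀ w → G* w u ≡ G* w v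
  twins-G*′ {u} {v} t w = trans (G*-sym w u) (trans (twins-G* t w) (G*-sym v w))

  twins-of-all-shares : ∀ {u v} → Partners u v →
    shares u v (cls u) ∧ shares u v (cls v) ≡ true →
    shares u v (opposite (cls u)) ∧ shares u v (partner (opposite (cls u))) ≡ true → Twins u v
  twins-of-all-shares {V₁ , _} {V₂ , _} (V₁-leading , refl) own opp = λ
    { V₁ → does≡true⇒ (∧-conicalˡ _ _ own) ; V₂ → does≡true⇒ (∧-conicalʳ _ _ own)
    ; V₃ → does≡true⇒ (∧-conicalˡ _ _ opp) ; V₄ → does≡true⇒ (∧-conicalʳ _ _ opp) }
  twins-of-all-shares {V₃ , _} {V₄ , _} (V₃-leading , refl) own opp = λ
    { V₁ → does≡true⇒ (∧-conicalˡ _ _ opp) ; V₂ → does≡true⇒ (∧-conicalʳ _ _ opp)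
    ; V₃ → does≡true⇒ (∧-conicalˡ _ _ own) ; V₄ → does≡true⇒ (∧-conicalʳ _ _ own) }

  shares-both : ∀ {u v c d} → nbIdx u c ≡ nbIdx v c → nbIdx u d ≡ nbIdx v d → shares u v c ∧ shares u v d ≡ true
  shares-both e e′ = cong₂ _∧_ (dec-true (_ ≟ _) e) (dec-true (_ ≟ _) e′)

  -- Agreeing on one side forces agreement on the other (partners-balance), hence on all four classes.
  twins-of-agreement : ∀ {u v} → Partners u v → ∀ {c} → Leading c →
    nbIdx u c ≡ nbIdx v c → nbIdx u (partner c) ≡ nbIdx v (partner c) → Twins u v
  twins-of-agreement p lc e e′ with leading-same-or-opposite (proj₁ p) lc | proj₂ p
  ... | inj₁ refl | refl = twins-of-all-shares p (shares-both e e′) (trans (sym (partners-balance p)) (shares-both e e′))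
  ... | inj₂ refl | refl = twins-of-all-shares p (trans (partners-balance p) (shares-both e e′)) (shares-both e e′)

  twins-propagate : ∀ {u v} → Partners u v → Twins u v → ∀ {c} → Leading c →
    Twins (nb u c) (nb u (partner c))
  twins-propagate {u} {v} p t {c} lc with proj₂ p
  ... | refl = twins-of-agreement (lc , refl) (proj₁ p) (agree-via u (nb-nb u)) (agree-via v via-v)
    where
    via-v : ∀ d → nb (nb u d) (cls v) ≡ v
    via-v d = trans (cong (λ z → nb z (cls v)) (twins-nb t d)) (nb-nb v d)
    agree-via : ∀ w → (∀ d → nb (nb u d) (cls w) ≡ w) → nbIdx (nb u c) (cls w) ≡ nbIdx (nb u (partner c)) (cls w)
    agree-via w back = cong proj₂ (trans (back c) (sym (back (partner c))))

  twins-adj-flip : ∀ {u v} → Twins u v → ∀ c k → swapped (cls v) c ≡ not (swapped (cls u) c) →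
    adj v (c , k) ≡ not (adj u (c , k))
  twins-adj-flip {u} {v} t c k flip = begin
    adj v (c , k)                                        ≡⟨ adj-point v c k ⟩
    swapped (cls v) c xor does (k ≟ nbIdx v c)           ≡⟨ cong₂ _xor_ flip (cong (λ i → does (k ≟ i)) (sym (t c))) ⟩
    not (swapped (cls u) c) xor does (k ≟ nbIdx u c)     ≡⟨ not-distribˡ-xor (swapped (cls u) c) _ ⟨
    not (swapped (cls u) c xor does (k ≟ nbIdx u c))     ≡⟨ cong not (adj-point u c k) ⟨
    not (adj u (c , k))                                  ∎
    where open ≡-Reasoning

  twins⇒type2c : ∀ {u v} → Partners u v → Twins u v → Type2cOrd adj u v
  twins⇒type2c {V₁ , _} {V₂ , _} (V₁-leading , refl) t = inj₁ (refl , refl , λ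
    { (V₁ , k) _ p → trans (twins-adj-flip t V₁ k refl) (cong not p)
    ; (V₂ , k) _ p → trans (twins-adj-flip t V₂ k refl) (cong not p) })
  twins⇒type2c {V₃ , _} {V₄ , _} (V₃-leading , refl) t = inj₂ (refl , refl , λ
    { (V₃ , k) _ p → trans (twins-adj-flip t V₃ k refl) (cong not p)
    ; (V₄ , k) _ p → trans (twins-adj-flip t V₄ k refl) (cong not p) })

  adj-nb-own : ∀ u → adj u (nb u (cls u)) ≡ true
  adj-nb-own u = trans (adj-point u (cls u) _)
    (cong₂ _xor_ (swapped-irrefl (cls u)) (dec-true (nbIdx u (cls u) ≟ nbIdx u (cls u)) refl))

  non-adj⇒agree : ∀ u v c → swapped (cls u) c ≡ true → adj u (c , nbIdx v c) ≡ false → nbIdx v c ≡ nbIdx u c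
  non-adj⇒agree u v c sw p =
    does≡true⇒ (not-injective {y = true}
      (trans (cong (_xor does (nbIdx v c ≟ nbIdx u c)) (sym sw)) (trans (sym (adj-point u c _)) p)))

  no-common⇒twins : ∀ {u v} → Partners u v →
    (adj u (nb u (cls u)) ≡ true → adj v (nb u (cls u)) ≡ false) →
    (adj u (nb v (cls v)) ≡ true → adj v (nb v (cls v)) ≡ false) → Twins u v
  no-common⇒twins {u} {v} p none-u none-v with proj₂ p
  ... | refl = twins-of-agreement p (proj₁ p)
    (non-adj⇒agree v u (cls u) (trans (swapped-sym _ _) (swapped-partner (cls u))) (none-u (adj-nb-own u)))
    (sym (non-adj⇒agree u v (cls v) (swapped-partner (cls u))
      (¬-not λ adj-u → contradiction (trans (sym (adj-nb-own v)) (none-v adj-u)) λ ())))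

  type2c⇒twins : ∀ {x y} → Type2cOrd adj x y → Partners x y × Twins x y
  type2c⇒twins {V₁ , _} {V₂ , _} (inj₁ (_ , _ , none)) =
    (V₁-leading , refl) , no-common⇒twins (V₁-leading , refl) (none _ refl) (none _ refl)
  type2c⇒twins {V₃ , _} {V₄ , _} (inj₂ (_ , _ , none)) =
    (V₃-leading , refl) , no-common⇒twins (V₃-leading , refl) (none _ refl) (none _ refl)
  type2c⇒twins {V₁ , _} {V₁ , _} (inj₁ (_ , () , _))
  type2c⇒twins {V₁ , _} {fs (fs _) , _} (inj₁ (_ , () , _))
  type2c⇒twins {fs _ , _} (inj₁ (() , _))
  type2c⇒twins {V₃ , _} {V₁ , _} (inj₂ (_ , () , _))
  type2c⇒twins {V₃ , _} {V₂ , _} (inj₂ (_ , () , _))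
  type2c⇒twins {V₃ , _} {V₃ , _} (inj₂ (_ , () , _))
  type2c⇒twins {V₁ , _} (inj₂ (() , _))
  type2c⇒twins {V₂ , _} (inj₂ (() , _))
  type2c⇒twins {V₄ , _} (inj₂ (() , _))

  mate : Vtx n → Vtx n
  mate u = nb u (cls u)

  mate-≢ : ∀ u → mate u ≢ u
  mate-≢ u eq = contradiction (trans (sym (nb-adjacent u (cls u))) (trans (cong (G* u) eq) (G*-irrefl u))) λ ()

  twins⇒induced-C4 : ∀ {x y} → Partners x y → Twins x y → (S : Vtx n → Bool) →
    S x ≡ true → S (mate x) ≡ true → S y ≡ true → S (mate y) ≡ true → HasInduced4Cycle G* S
  twins⇒induced-C4 {x} {y} p t S sx smx sy smy =
    x , mate x , y , mate y , (sx , smx , sy , smy) ,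
    (mate-≢ x ∘ sym , apart ∘ cong cls , apart ∘ cong cls , apart ∘ cong cls , apart ∘ cong cls , mate-≢ y ∘ sym) ,
    (nb-adjacent x (cls x) , mate-x∼y , nb-adjacent y (cls y) , mate-y∼x) ,
    (¬-not (λ x∼y → mate-≢ y (sym (trans (nb-unique x y x∼y) (twins-nb t (cls y))))) ,
     ¬-not (λ m∼m → mate-≢ y (trans (nb-unique (mate x) (mate y) m∼m)
                               (trans (cong (λ z → nb z (cls y)) (twins-nb t (cls x))) (nb-nb y (cls x))))))
    where
    apart : cls x ≢ cls y
    apart x≡y = partner-≢ (cls x) (sym (trans x≡y (proj₂ p)))
    mate-x∼y : G* (mate x) y ≡ true
    mate-x∼y = trans (cong (λ z → G* z y) (twins-nb t (cls x))) (trans (G*-sym _ y) (nb-adjacent y (cls x)))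
    mate-y∼x : G* (mate y) x ≡ true
    mate-y∼x = trans (cong (λ z → G* z x) (sym (twins-nb t (cls y)))) (trans (G*-sym _ x) (nb-adjacent x (cls y)))

  SameSide : Vtx n → Vtx n → Set
  SameSide a v = cls v ≡ cls a ⊎ cls v ≡ partner (cls a)

  G*-sym-edge : ∀ {u v} → G* u v ≡ true → G* v u ≡ true
  G*-sym-edge {u} {v} = trans (G*-sym v u)

  nb-of : ∀ u v → G* u v ≡ true → nb u (cls v) ≡ v
  nb-of u v uv = sym (nb-unique u v uv)

  SquareAgreement : Vtx n → Vtx n → Set
  SquareAgreement a c = cls c ≡ partner (cls a) × nbIdx a (cls a) ≡ nbIdx c (cls a) × nbIdx a (cls c) ≡ nbIdx c (cls c)

  square-through-mate : ∀ a b c d → a ≢ c → b ≢ d →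
    G* a b ≡ true → G* b c ≡ true → G* c d ≡ true → G* d a ≡ true →
    SameSide a c → SameSide a d → cls b ≡ cls a → SquareAgreement a c
  square-through-mate a b c d a≢c b≢d ab bc cd da side-c side-d b∈a = c∈a′ , cong proj₂ via-b , cong proj₂ via-d
    where
    b-mate : nb a (cls a) ≡ b
    b-mate = trans (cong (nb a) (sym b∈a)) (nb-of a b ab)
    d∈a′ : cls d ≡ partner (cls a)
    d∈a′ = right-unless (λ e → b≢d (trans (sym b-mate) (trans (cong (nb a) (sym e)) (nb-of a d (G*-sym-edge da))))) side-d
    c∈a′ : cls c ≡ partner (cls a)
    c∈a′ = right-unless (λ e → a≢c (trans (sym (nb-back a b ab)) (trans (cong (nb b) (sym e)) (nb-of b c bc)))) side-c
    via-b : nb a (cls a) ≡ nb c (cls a)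
    via-b = trans b-mate (sym (trans (cong (nb c) (sym b∈a)) (nb-of c b (G*-sym-edge bc))))
    via-d : nb a (cls c) ≡ nb c (cls c)
    via-d = trans (cong (nb a) c≡d) (trans (nb-of a d (G*-sym-edge da)) (sym (trans (cong (nb c) c≡d) (nb-of c d cd))))
      where
      c≡d : cls c ≡ cls d
      c≡d = trans c∈a′ (sym d∈a′)

  agreement⇒type2c : ∀ a c → SquareAgreement a c → Type2c adj a c
  agreement⇒type2c a (_ , k) (refl , e , e′) with leading-or-partner (cls a)
  ... | inj₁ la  = inj₁ (twins⇒type2c (la , refl) (twins-of-agreement (la , refl) la e e′))
  ... | inj₂ la′ = inj₂ (twins⇒type2c p (twins-of-agreement p la′ (sym e′)
                     (subst (λ z → nbIdx c z ≡ nbIdx a z) (sym (partner-involutive (cls a))) (sym e))))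
    where
    c : Vtx n
    c = partner (cls a) , k
    p : Partners c a
    p = la′ , sym (partner-involutive (cls a))

  square⇒type2c : ∀ a b c d → a ≢ c → b ≢ d →
    G* a b ≡ true → G* b c ≡ true → G* c d ≡ true → G* d a ≡ true →
    SameSide a b → SameSide a c → SameSide a d → Type2c adj a c
  square⇒type2c a b c d a≢c b≢d ab bc cd da side-b side-c side-d with side-b
  ... | inj₁ b∈a  = agreement⇒type2c a c (square-through-mate a b c d a≢c b≢d ab bc cd da side-c side-d b∈a)
  ... | inj₂ b∈a′ = agreement⇒type2c a c (square-through-mate a d c b a≢c (b≢d ∘ sym)
                      (G*-sym-edge da) (G*-sym-edge cd) (G*-sym-edge bc) (G*-sym-edge ab) side-c side-b d∈a)
    where
    d∈a : cls d ≡ cls a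
    d∈a = left-unless (λ e → b≢d (trans (sym (nb-of a b ab))
            (trans (cong (nb a) (trans b∈a′ (sym e))) (nb-of a d (G*-sym-edge da))))) side-d

  move : Bool → Vtx n → Vtx n
  move b u = nb u (stepClass b (cls u))

  move-involutive : ∀ b u → move b (move b u) ≡ u
  move-involutive b u = trans (cong (nb (move b u)) (stepClass-involutive b (cls u))) (nb-nb u (stepClass b (cls u)))

  move-injective : ∀ b {u v} → move b u ≡ move b v → u ≡ v
  move-injective b {u} {v} e = trans (sym (move-involutive b u)) (trans (cong (move b) e) (move-involutive b v))

  move-≢ : ∀ b u → move b u ≢ u
  move-≢ true  u = mate-≢ u
  move-≢ false u = opposite-≢ (cls u) ∘ cong cls

  twinOf : Vtx n → Vtx n
  twinOf u = nb (mate u) (partner (cls u))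

  twinOf-unique : ∀ {u v} → Twins u v → cls v ≡ partner (cls u) → twinOf u ≡ v
  twinOf-unique {u} {v} t v∈u′ = trans (cong₂ nb (twins-nb t (cls u)) (sym v∈u′)) (nb-nb v (cls u))

  HasTwin : Vtx n → Set
  HasTwin u = Twins u (twinOf u)

  hasTwin-intro : ∀ {u v} → Twins u v → cls v ≡ partner (cls u) → HasTwin u
  hasTwin-intro {u} t v∈u′ = subst (Twins u) (sym (twinOf-unique t v∈u′)) t

  hasTwin-move : ∀ b {u} → Leading (cls u) → HasTwin u → HasTwin (move b u)
  hasTwin-move b lu t = hasTwin-intro (twins-propagate (lu , refl) t (leading-stepClass b lu)) refl

  twinOf-injective : ∀ {u v} → HasTwin u → HasTwin v → twinOf u ≡ twinOf v → u ≡ v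
  twinOf-injective {u} {v} tu tv e = trans (sym (back u tu)) (trans (cong₂ (λ z c → nb (nb z c) c) e cls≡) (back v tv))
    where
    back : ∀ w → HasTwin w → nb (nb (twinOf w) (cls w)) (cls w) ≡ w
    back w tw = trans (cong (λ z → nb z (cls w)) (sym (twins-nb tw (cls w)))) (nb-nb w (cls w))
    cls≡ : cls u ≡ cls v
    cls≡ = trans (sym (partner-involutive (cls u))) (trans (cong (partner ∘ cls) e) (partner-involutive (cls v)))

  neighbour-cases : ∀ {u w} → Leading (cls u) → HasTwin u → G* u w ≡ true →
    Σ Bool λ b → w ≡ move b u ⊎ w ≡ twinOf (move b u)
  neighbour-cases {u} {w} lu t uw with leading-or-partner (cls w)
  ... | inj₁ lw with leading⇒stepClass lu lw
  ...   | b , e = b , inj₁ (trans (nb-unique u w uw) (cong (nb u) e))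
  neighbour-cases {u} {w} lu t uw | inj₂ lw′ with leading⇒stepClass lu lw′
  ...   | b , e = b , inj₂ (trans (nb-unique u w uw) (trans (cong (nb u) w∈x′) (sym (nb-unique u (twinOf x) u∼twin))))
    where
    x : Vtx n
    x = move b u
    w∈x′ : cls w ≡ partner (cls x)
    w∈x′ = trans (sym (partner-involutive (cls w))) (cong partner e)
    u∼twin : G* u (twinOf x) ≡ true
    u∼twin = trans (sym (twins-G*′ (hasTwin-move b lu t) u)) (nb-adjacent u _)

  walkFrom : Vtx n → ℕ → Vtx n
  walkFrom v zero    = v
  walkFrom v (suc i) = move (mateStep i) (walkFrom v i)

  walkFrom-injective : ∀ {v w} i → walkFrom v i ≡ walkFrom w i → v ≡ w
  walkFrom-injective zero    e = e
  walkFrom-injective (suc i) e = walkFrom-injective i (move-injective (mateStep i) e)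

  walkFrom-+4k : ∀ v k i → walkFrom v (k * 4 + i) ≡ walkFrom (walkFrom v (k * 4)) i
  walkFrom-+4k v k zero    = cong (walkFrom v) (ℕ.+-identityʳ (k * 4))
  walkFrom-+4k v k (suc i) rewrite ℕ.+-suc (k * 4) i | mateStep-+4k k i =
    cong (move (mateStep i)) (walkFrom-+4k v k i)

  walkFrom-cls : ∀ v i → cls v ≡ V₁ → cls (walkFrom v i) ≡ walkClass i
  walkFrom-cls v zero    v∈V₁ = v∈V₁
  walkFrom-cls v (suc i) v∈V₁ = trans (cong (stepClass (mateStep i)) (walkFrom-cls v i v∈V₁)) (sym (walkClass-suc i))

  even-coincidence : ∀ v i d → mateStep i ≡ mateStep (i + d) → walkFrom v i ≡ walkFrom v (i + d) →
    v ≡ walkFrom v d × mateStep d ≡ true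
  even-coincidence v zero    d same-step e = e , sym same-step
  even-coincidence v (suc i) d same-step e = even-coincidence v i d same-step′
    (move-injective (mateStep i) (trans e (cong (λ b → move b (walkFrom v (i + d))) (sym same-step′))))
    where
    same-step′ : mateStep i ≡ mateStep (i + d)
    same-step′ = not-injective (trans (sym (mateStep-suc i)) (trans same-step (mateStep-suc (i + d))))

  -- Both ends of an odd-length coincidence step inwards until they are adjacent.
  odd-coincidence : ∀ v k i → mateStep (suc (k + i)) ≡ not (mateStep i) → walkFrom v i ≢ walkFrom v (suc (k + i))
  odd-coincidence v zero          i _        e = move-≢ (mateStep i) (walkFrom v i) (sym e)
  odd-coincidence v (suc zero)    i opposite _ = not-¬ refl opposite
  odd-coincidence v (suc (suc k)) i opposite e = odd-coincidence v k (suc i) opposite′ e′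
    where
    w : ℕ → Vtx n
    w = walkFrom v
    same : mateStep (k + i) ≡ mateStep i
    same = not-injective (trans (sym (mateStep-suc (k + i))) opposite)
    e′ : w (suc i) ≡ w (suc (k + suc i))
    e′ = begin
      move (mateStep i) (w i)                                      ≡⟨ cong₂ move (sym same) e ⟩
      move (mateStep (k + i)) (move (mateStep (k + i)) (w (suc (suc (k + i)))))
                                                                   ≡⟨ move-involutive (mateStep (k + i)) _ ⟩
      w (suc (suc (k + i)))                                        ≡⟨ cong (w ∘ suc) (ℕ.+-suc k i) ⟨
      w (suc (k + suc i))                                          ∎
      where open ≡-Reasoning
    opposite′ : mateStep (suc (k + suc i)) ≡ not (mateStep (suc i))
    opposite′ = trans (cong (mateStep ∘ suc) (ℕ.+-suc k i))
                  (trans same (trans (sym (not-involutive _)) (cong not (sym (mateStep-suc i)))))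

  module Cycle (a₀ : Fin n) (twin₀ : HasTwin (V₁ , a₀)) where
    x₀ : Vtx n
    x₀ = V₁ , a₀

    walk : ℕ → Vtx n
    walk = walkFrom x₀

    walk-cls : ∀ i → cls (walk i) ≡ walkClass i
    walk-cls i = walkFrom-cls x₀ i refl

    walk-leading : ∀ i → Leading (cls (walk i))
    walk-leading i = subst Leading (sym (walk-cls i)) (walkClass-leading i)

    walk-hasTwin : ∀ i → HasTwin (walk i)
    walk-hasTwin zero    = twin₀
    walk-hasTwin (suc i) = hasTwin-move (mateStep i) (walk-leading i) (walk-hasTwin i)

    -- All walk (k * 4) lie in V₁, so two of the first n + 1 of them coincide.
    walk-returns : Σ ℕ λ k → walk (suc k * 4) ≡ x₀
    walk-returns with pigeonhole (ℕ.n<1+n n) (λ k → proj₂ (walk (toℕ k * 4)))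
    ... | i , j , i<j , same-index with ℕ.m≤n⇒∃[o]m+o≡n i<j
    ... | k , i+k≡j = k , walkFrom-injective (toℕ i * 4)
      (trans (sym (walkFrom-+4k x₀ (suc k) (toℕ i * 4))) (trans (cong walk offset) (same-vertex j i (sym same-index))))
      where
      offset : suc k * 4 + toℕ i * 4 ≡ toℕ j * 4
      offset = trans (sym (ℕ.*-distribʳ-+ 4 (suc k) (toℕ i))) (cong (_* 4) (trans (cong suc (ℕ.+-comm k (toℕ i))) i+k≡j))
      same-vertex : ∀ l l′ → proj₂ (walk (toℕ l * 4)) ≡ proj₂ (walk (toℕ l′ * 4)) →
        walk (toℕ l * 4) ≡ walk (toℕ l′ * 4)
      same-vertex l l′ same = ×-≡,≡→≡ (trans (walk-cls (toℕ l * 4)) (trans (walkClass-4k (toℕ l))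
                                (sym (trans (walk-cls (toℕ l′ * 4)) (walkClass-4k (toℕ l′))))) , same)

    abstract
      period-search : Σ ℕ λ k → walk (suc k * 4) ≡ x₀ × (∀ l → l < k → walk (suc l * 4) ≢ x₀)
      period-search =
        least-witness _ (λ k → ≡-dec _≟_ _≟_ (walk (suc k * 4)) x₀) (proj₁ walk-returns) (proj₂ walk-returns)

    m : ℕ
    m = suc (proj₁ period-search)

    t : ℕ
    t = m * 4

    walk-period : walk t ≡ x₀
    walk-period = proj₁ (proj₂ period-search)

    walk-minimal : ∀ q → 0 < q → q < m → walk (q * 4) ≢ x₀
    walk-minimal (suc q) _ (s≤s q<m′) = proj₂ (proj₂ period-search) q q<m′

    no-early-return : ∀ d → 0 < d → d < t → walk d ≡ x₀ → mateStep d ≡ true → ⊥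
    no-early-return d 0<d d<t back mate-step
      with walkClass≡V₁⇒4k d (trans (sym (walk-cls d)) (cong cls back)) mate-step
    ... | zero  , refl = ℕ.<-irrefl refl 0<d
    ... | suc q , refl = walk-minimal (suc q) (s≤s z≤n) (ℕ.*-cancelʳ-< 4 (suc q) m d<t) back

    walk-no-return : ∀ {i j} → i < j → j < t → walk i ≢ walk j
    walk-no-return {i} i<j j<t e with ℕ.m≤n⇒∃[o]m+o≡n i<j
    ... | k , refl with mateStep (suc (k + i)) ≟ᵇ mateStep i
    ...   | no  differ = odd-coincidence x₀ k i (¬-not differ) (trans e (cong (walk ∘ suc) (ℕ.+-comm i k)))
    ...   | yes same   = no-early-return (suc k) (s≤s z≤n) (ℕ.≤-<-trans (ℕ.m≤n+m (suc k) i) (subst (_< t) (sym j≡) j<t))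
                           (sym (proj₁ even)) (proj₂ even)
      where
      j≡ : i + suc k ≡ suc (i + k)
      j≡ = ℕ.+-suc i k
      even : x₀ ≡ walk (suc k) × mateStep (suc k) ≡ true
      even = even-coincidence x₀ i (suc k)
               (sym (trans (cong mateStep (trans j≡ (cong suc (ℕ.+-comm i k)))) same)) (trans e (cong walk (sym j≡)))

    walk-injective : ∀ {i j} → i < t → j < t → walk i ≡ walk j → i ≡ j
    walk-injective {i} {j} i<t j<t e with ℕ.<-cmp i j
    ... | tri< i<j _ _ = ⊥-elim (walk-no-return i<j j<t e)
    ... | tri≈ _ i≡j _ = i≡j
    ... | tri> _ _ j<i = ⊥-elim (walk-no-return j<i i<t (sym e))

    next : ℕ → ℕ
    next i = if suc i ≡ᵇ t then 0 else suc i

    prev : ℕ → ℕ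
    prev zero    = t ∸ 1
    prev (suc i) = i

    next<t : ∀ i → i < t → next i < t
    next<t i i<t with suc i ≡ᵇ t in last
    ... | true  = s≤s z≤n
    ... | false = ℕ.≤∧≢⇒< i<t λ i+1≡t → contradiction (trans (sym (≡⇒≡ᵇ i+1≡t)) last) λ ()

    prev<t : ∀ i → i < t → prev i < t
    prev<t zero    _   = ℕ.≤-refl
    prev<t (suc i) i<t = ℕ.<-trans (ℕ.n<1+n i) i<t

    walk-next : ∀ i → walk (next i) ≡ move (mateStep i) (walk i)
    walk-next i with suc i ≡ᵇ t in last
    ... | true  = trans (sym walk-period) (cong walk (sym (≡ᵇ⇒≡ (suc i) t last)))
    ... | false = refl

    isNext-next : ∀ i → isNext t i (next i) ≡ true
    isNext-next i with suc i ≡ᵇ t in last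
    ... | true  = refl
    ... | false = cong (_∨ false) (≡ᵇ-refl (suc i))

    isNext⇒next : ∀ i j → j < t → isNext t i j ≡ true → j ≡ next i
    isNext⇒next i j j<t nx with suc i ≡ᵇ t in last | ∨≡true⇒ (j ≡ᵇ suc i) _ nx
    ... | true  | inj₁ j≡ = ⊥-elim (ℕ.<-irrefl (trans (≡ᵇ⇒≡ _ _ j≡) (≡ᵇ⇒≡ _ _ last)) j<t)
    ... | true  | inj₂ j≡ = ≡ᵇ⇒≡ j 0 j≡
    ... | false | inj₁ j≡ = ≡ᵇ⇒≡ _ _ j≡

    next-prev : ∀ i → i < t → next (prev i) ≡ i
    next-prev zero    _   rewrite ≡ᵇ-refl t = refl
    next-prev (suc i) i<t rewrite ≢⇒≡ᵇ-false (suc i) t (λ i+1≡t → ℕ.<-irrefl i+1≡t i<t) = refl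

    mateStep-prev : ∀ i → mateStep (prev i) ≡ not (mateStep i)
    mateStep-prev zero    = trans (mateStep-suc (proj₁ period-search * 4)) (cong not (mateStep-4k (proj₁ period-search)))
    mateStep-prev (suc i) = sym (trans (cong not (mateStep-suc i)) (not-involutive (mateStep i)))

    walk-prev : ∀ i → i < t → walk (prev i) ≡ move (not (mateStep i)) (walk i)
    walk-prev i i<t = begin
      walk (prev i)                                              ≡⟨ move-involutive (mateStep (prev i)) _ ⟨
      move (mateStep (prev i)) (move (mateStep (prev i)) (walk (prev i))) ≡⟨ cong (move _) (walk-next (prev i)) ⟨
      move (mateStep (prev i)) (walk (next (prev i)))            ≡⟨ cong₂ move (mateStep-prev i) (cong walk (next-prev i i<t)) ⟩
      move (not (mateStep i)) (walk i)                           ∎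
      where open ≡-Reasoning

    move-index : ∀ i b → i < t → Σ ℕ λ j → j < t × walk j ≡ move b (walk i)
    move-index i b i<t with b ≟ᵇ mateStep i
    ... | yes refl = next i , next<t i i<t , walk-next i
    ... | no  b≢   = prev i , prev<t i i<t , trans (walk-prev i i<t) (cong (λ c → move c (walk i)) (sym (¬-not b≢)))

    move-index-adjacent : ∀ {i j} b → i < t → j < t → walk j ≡ move b (walk i) → cycAdj t i j ≡ true
    move-index-adjacent {i} {j} b i<t j<t e with b ≟ᵇ mateStep i
    ... | yes refl with walk-injective j<t (next<t i i<t) (trans e (sym (walk-next i)))
    ...   | refl = cong (_∨ isNext t j i) (isNext-next i)
    move-index-adjacent {i} {j} b i<t j<t e | no b≢
      with walk-injective j<t (prev<t i i<t)
             (trans e (trans (cong (λ c → move c (walk i)) (¬-not b≢)) (sym (walk-prev i i<t))))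
    ...   | refl =
      trans (cong (isNext t i j ∨_) (subst (λ k → isNext t j k ≡ true) (next-prev i i<t) (isNext-next j))) (∨-zeroʳ _)

    G*-walk : ∀ {i j} → i < t → j < t → G* (walk i) (walk j) ≡ cycAdj t i j
    G*-walk {i} {j} i<t j<t = true-iff⇒≡ fwd bwd
      where
      fwd : G* (walk i) (walk j) ≡ true → cycAdj t i j ≡ true
      fwd e with neighbour-cases (walk-leading i) (walk-hasTwin i) e
      ... | b , inj₁ e′ = move-index-adjacent b i<t j<t e′
      ... | b , inj₂ e′ = ⊥-elim (partner-not-leading (leading-stepClass b (walk-leading i))
                                   (subst Leading (cong cls e′) (walk-leading j)))
      edge : ∀ {i j} → j < t → isNext t i j ≡ true → G* (walk i) (walk j) ≡ true
      edge {i} j<t nx = trans (cong (G* (walk i) ∘ walk) (isNext⇒next i _ j<t nx))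
                              (trans (cong (G* (walk i)) (walk-next i)) (nb-adjacent (walk i) _))
      bwd : cycAdj t i j ≡ true → G* (walk i) (walk j) ≡ true
      bwd c with ∨≡true⇒ (isNext t i j) _ c
      ... | inj₁ i→j = edge j<t i→j
      ... | inj₂ j→i = G*-sym-edge (edge i<t j→i)

    copy : ℕ → Fin 2 → Vtx n
    copy i f0      = walk i
    copy i (fs f0) = twinOf (walk i)

    copy-twins : ∀ i κ → Twins (walk i) (copy i κ)
    copy-twins i f0      _ = refl
    copy-twins i (fs f0)   = walk-hasTwin i

    G*-copy : ∀ i κ j κ′ → G* (copy i κ) (copy j κ′) ≡ G* (walk i) (walk j)
    G*-copy i κ j κ′ = trans (sym (twins-G* (copy-twins i κ) _)) (sym (twins-G*′ (copy-twins j κ′) _))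

    copy-injective : ∀ {i j} κ κ′ → i < t → j < t → copy i κ ≡ copy j κ′ → i ≡ j × κ ≡ κ′
    copy-injective f0      f0      i<t j<t e = walk-injective i<t j<t e , refl
    copy-injective (fs f0) (fs f0) i<t j<t e =
      walk-injective i<t j<t (twinOf-injective (walk-hasTwin _) (walk-hasTwin _) e) , refl
    copy-injective {i} {j} f0 (fs f0) _ _ e =
      ⊥-elim (partner-not-leading (walk-leading j) (subst Leading (cong cls e) (walk-leading i)))
    copy-injective {i} {j} (fs f0) f0 _ _ e =
      ⊥-elim (partner-not-leading (walk-leading i) (subst Leading (cong cls (sym e)) (walk-leading j)))

    InCopies : Vtx n → Set
    InCopies w = Σ ℕ λ j → Σ (Fin 2) λ κ → j < t × copy j κ ≡ w

    copies-closed : ∀ i κ w → i < t → G* (copy i κ) w ≡ true → InCopies w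
    copies-closed i κ w i<t e
      with neighbour-cases (walk-leading i) (walk-hasTwin i) (trans (twins-G* (copy-twins i κ) w) e)
    ... | b , inj₁ w≡ = let (j , j<t , walk-j) = move-index i b i<t in j , f0 , j<t , trans walk-j (sym w≡)
    ... | b , inj₂ w≡ = let (j , j<t , walk-j) = move-index i b i<t in j , fs f0 , j<t , trans (cong twinOf walk-j) (sym w≡)

    copies-reach : ∀ {u v} → Walk G* u v → InCopies u → InCopies v
    copies-reach here            c                  = c
    copies-reach (step {w = w} e rest) (j , κ , j<t , copy-j) =
      copies-reach rest (copies-closed j κ w j<t (trans (cong (λ z → G* z w) copy-j) e))

    module Spanning (D : Vtx n → Bool) (comp : IsComponent G* D) (D₀ : D x₀ ≡ true) where
      open IsComponent comp

      walk-in-D : ∀ i → D (walk i) ≡ true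
      walk-in-D zero    = D₀
      walk-in-D (suc i) = closed _ _ (walk-in-D i) (nb-adjacent (walk i) _)

      copy-in-D : ∀ i κ → D (copy i κ) ≡ true
      copy-in-D i f0      = walk-in-D i
      copy-in-D i (fs f0) = closed _ _ (walk-in-D (suc i))
        (trans (sym (twins-G*′ (walk-hasTwin i) (walk (suc i)))) (G*-sym-edge (nb-adjacent (walk i) _)))

      in-copies : ∀ v → D v ≡ true → InCopies v
      in-copies v Dv = copies-reach (connected x₀ v D₀ Dv) (0 , f0 , s≤s z≤n , refl)

      side-copy : ∀ i κ → side (cls (copy i κ)) ≡ side (walkClass i)
      side-copy i f0      = cong side (walk-cls i)
      side-copy i (fs f0) = trans (side-partner (cls (walk i))) (cong side (walk-cls i))

      alternating-lex : IsAlternatingLex adj D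
      alternating-lex = t , s≤s (s≤s (s≤s z≤n)) , divides m refl , g ,
        (g-injective , (λ (i , κ) → copy-in-D (toℕ i) κ) , g-onto , g-adj) ,
        (λ i → inj₁ (twins⇒type2c (walk-leading (toℕ i) , refl) (walk-hasTwin (toℕ i)))) ,
        (λ i κ → trans (side-copy (toℕ i) κ) (side-walkClass (toℕ i)))
        where
        g : Fin t × Fin 2 → Vtx n
        g (i , κ) = copy (toℕ i) κ
        g-injective : ∀ p q → g p ≡ g q → p ≡ q
        g-injective (i , κ) (j , κ′) e with copy-injective κ κ′ (toℕ<n i) (toℕ<n j) e
        ... | i≡j , refl = cong (_, κ) (toℕ-injective i≡j)
        g-onto : ∀ v → D v ≡ true → ∃ λ p → g p ≡ v
        g-onto v Dv with in-copies v Dv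
        ... | j , κ , j<t , copy-j = (fromℕ< j<t , κ) , trans (cong (λ i → copy i κ) (toℕ-fromℕ< j<t)) copy-j
        g-adj : ∀ p q → G* (g p) (g q) ≡ lexC p q
        g-adj (i , κ) (j , κ′) = trans (G*-copy _ κ _ κ′) (G*-walk (toℕ<n i) (toℕ<n j))

      module HalfBlocks (far : Bool) where
        pos : Fin 4 → ℕ
        pos a = halfPos far (c4Row a)

        onBlock : Fin m × Fin 4 → Vtx n
        onBlock (q , a) = copy (toℕ q * 4 + pos a) (c4Copy a)

        onBlock-index< : ∀ (q : Fin m) a → toℕ q * 4 + pos a < t
        onBlock-index< q a = block-< (toℕ<n q) (halfPos<4 far (c4Row a))

        inHalf-copy : ∀ j κ → inHalf far (cls (copy j κ)) ≡ inHalf far (walkClass j)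
        inHalf-copy j κ = cong (far xor_) (side-copy j κ)

        onBlock-injective : ∀ p p′ → onBlock p ≡ onBlock p′ → p ≡ p′
        onBlock-injective (q , a) (q′ , a′) e
          with copy-injective (c4Copy a) (c4Copy a′) (onBlock-index< q a) (onBlock-index< q′ a′) e
        ... | same-index , same-copy
          with block-unique (toℕ q) (toℕ q′) (pos a) (pos a′) (halfPos<4 far _) (halfPos<4 far _) same-index
        ... | same-block , same-pos = cong₂ _,_ (toℕ-injective same-block) (begin
          a                                  ≡⟨ c4Vertex-row-copy a ⟨
          c4Vertex (c4Row a) (c4Copy a)      ≡⟨ cong₂ c4Vertex (halfPos-injective far same-pos) same-copy ⟩
          c4Vertex (c4Row a′) (c4Copy a′)    ≡⟨ c4Vertex-row-copy a′ ⟩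
          a′                                 ∎)
          where open ≡-Reasoning

        onBlock-inHalf : ∀ p → D (onBlock p) ∧ inHalf far (cls (onBlock p)) ≡ true
        onBlock-inHalf (q , a) = cong₂ _∧_ (copy-in-D i (c4Copy a))
          (trans (inHalf-copy i (c4Copy a))
            (trans (cong (inHalf far) (walkClass-+4k (toℕ q) (pos a))) (halfPos-inHalf far (c4Row a))))
          where
          i : ℕ
          i = toℕ q * 4 + pos a

        onBlock-onto : ∀ v → D v ∧ inHalf far (cls v) ≡ true → ∃ λ p → onBlock p ≡ v
        onBlock-onto v Sv with in-copies v (∧-conicalˡ _ _ Sv)
        ... | j , κ , j<t , copy-j with block-decompose j
        ... | q , r , r<4 , j≡ with inHalf⇒halfPos far r r<4 in-half
          where
          in-half : inHalf far (walkClass r) ≡ true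
          in-half = trans (cong (inHalf far) (sym (walkClass-+4k q r)))
                      (trans (cong (inHalf far ∘ walkClass) (sym j≡))
                        (trans (sym (inHalf-copy j κ)) (trans (cong (inHalf far ∘ cls) copy-j) (∧-conicalʳ _ _ Sv))))
        ... | ρ , ρ≡r = (fromℕ< q<m , c4Vertex ρ κ) , trans (cong₂ copy index (c4Copy-vertex ρ κ)) copy-j
          where
          q<m : q < m
          q<m = ℕ.*-cancelʳ-< 4 q m (ℕ.≤-<-trans (ℕ.m≤m+n (q * 4) r) (subst (_< t) j≡ j<t))
          index : toℕ (fromℕ< q<m) * 4 + pos (c4Vertex ρ κ) ≡ j
          index = trans (cong₂ (λ a b → a * 4 + halfPos far b) (toℕ-fromℕ< q<m) (c4Row-vertex ρ κ))
                        (trans (cong (q * 4 +_) ρ≡r) (sym j≡))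

        G*-onBlock : ∀ p p′ → G* (onBlock p) (onBlock p′) ≡ unionC4 p p′
        G*-onBlock (q , a) (q′ , a′) = begin
          G* (onBlock (q , a)) (onBlock (q′ , a′))
            ≡⟨ G*-copy _ (c4Copy a) _ (c4Copy a′) ⟩
          G* (walk (toℕ q * 4 + pos a)) (walk (toℕ q′ * 4 + pos a′))
            ≡⟨ G*-walk (onBlock-index< q a) (onBlock-index< q′ a′) ⟩
          cycAdj t (toℕ q * 4 + pos a) (toℕ q′ * 4 + pos a′)
            ≡⟨ cycAdj-blocks m (toℕ q) (toℕ q′) (pos a) (pos a′) (halfPos<4 far _) (halfPos<4 far _)
                 (halfPos-no-wrap far _ _) (halfPos-no-wrap far _ _) ⟩
          (toℕ q ≡ᵇ toℕ q′) ∧ ((pos a′ ≡ᵇ suc (pos a)) ∨ (pos a ≡ᵇ suc (pos a′)))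
            ≡⟨ cong ((toℕ q ≡ᵇ toℕ q′) ∧_) (c4-halfPos-adjacent far a a′) ⟩
          unionC4 (q , a) (q′ , a′)
            ∎
          where open ≡-Reasoning

      union-of-C4 : ∀ far → IsUnionOfC4 G* (λ v → D v ∧ inHalf far (cls v))
      union-of-C4 far = m , onBlock , onBlock-injective , onBlock-inHalf , onBlock-onto , G*-onBlock
        where open HalfBlocks far

  module Component {D : Vtx n → Bool} (comp : IsComponent G* D) where
    open IsComponent comp

    Half : Bool → Vtx n → Bool
    Half far v = D v ∧ inHalf far (cls v)

    TwinPair : Set
    TwinPair = Σ (Vtx n) λ u → Σ (Vtx n) λ v → D u ≡ true × D v ≡ true × Partners u v × Twins u v

    type2c⇒twinPair : ∀ {x y} → D x ≡ true → D y ≡ true → Type2c adj x y → TwinPair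
    type2c⇒twinPair Dx Dy (inj₁ xy) = _ , _ , Dx , Dy , type2c⇒twins xy
    type2c⇒twinPair Dx Dy (inj₂ yx) = _ , _ , Dy , Dx , type2c⇒twins yx

    twinPair⇒C4 : TwinPair → HasInduced4Cycle G* (Half false) ⊎ HasInduced4Cycle G* (Half true)
    twinPair⇒C4 ((V₁ , _) , (V₂ , _) , Du , Dv , p@(V₁-leading , refl) , t) =
      inj₁ (twins⇒induced-C4 p t _ (in-half Du) (in-half (mate-in-D Du)) (in-half Dv) (in-half (mate-in-D Dv)))
      where
      in-half : ∀ {v} → D v ≡ true → D v ∧ true ≡ true
      in-half = trans (∧-identityʳ _)
      mate-in-D : ∀ {v} → D v ≡ true → D (mate v) ≡ true
      mate-in-D Dv = closed _ _ Dv (nb-adjacent _ _)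
    twinPair⇒C4 ((V₃ , _) , (V₄ , _) , Du , Dv , p@(V₃-leading , refl) , t) =
      inj₂ (twins⇒induced-C4 p t _ (in-half Du) (in-half (mate-in-D Du)) (in-half Dv) (in-half (mate-in-D Dv)))
      where
      in-half : ∀ {v} → D v ≡ true → D v ∧ true ≡ true
      in-half = trans (∧-identityʳ _)
      mate-in-D : ∀ {v} → D v ≡ true → D (mate v) ≡ true
      mate-in-D Dv = closed _ _ Dv (nb-adjacent _ _)

    C4⇒type2c : ∀ far → HasInduced4Cycle G* (Half far) →
      Σ (Vtx n) λ x → Σ (Vtx n) λ y → D x ≡ true × D y ≡ true × Type2c adj x y
    C4⇒type2c far (a , b , c , d , (Sa , Sb , Sc , Sd) , (_ , a≢c , _ , _ , b≢d , _) , (ab , bc , cd , da) , _) =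
      a , c , ∧-conicalˡ _ _ Sa , ∧-conicalˡ _ _ Sc ,
      square⇒type2c a b c d a≢c b≢d ab bc cd da (same-side Sb) (same-side Sc) (same-side Sd)
      where
      same-side : ∀ {v} → Half far v ≡ true → SameSide a v
      same-side Sv = side≡⇒same-or-partner (cls a) _
        (xor-injectiveʳ far (trans (∧-conicalʳ _ _ Sv) (sym (∧-conicalʳ _ _ Sa))))

    twinPair⇒start : TwinPair → Σ (Fin n) λ a₀ → HasTwin (V₁ , a₀) × D (V₁ , a₀) ≡ true
    twinPair⇒start ((V₁ , a) , _ , Du , _ , (V₁-leading , refl) , t) = a , hasTwin-intro t refl , Du
    twinPair⇒start ((V₃ , a) , _ , Du , _ , (V₃-leading , refl) , t) =
      nbIdx (V₃ , a) V₁ , hasTwin-move false V₃-leading (hasTwin-intro t refl) , closed _ _ Du (nb-adjacent (V₃ , a) V₁)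

lemma5 : (n : ℕ) (adj : Graph n) →
    IsDDG n (n + 2) (n ∸ 2) 2 adj →
    HasQuotient adj →
    (D : Vtx n → Bool) → IsComponent (star adj) D →
    let Has2c = Σ (Vtx n) λ x → Σ (Vtx n) λ y →
                  D x ≡ true × D y ≡ true × Type2c adj x y
        D12 = λ v → D v ∧ in12 v
        D34 = λ v → D v ∧ in34 v
    in (Has2c ⇔ (HasInduced4Cycle (star adj) D12 ⊎ HasInduced4Cycle (star adj) D34))
       × (Has2c →
            IsUnionOfC4 (star adj) D12 × IsUnionOfC4 (star adj) D34 ×
            IsAlternatingLex adj D)
lemma5 n adj ddg hq D comp =
  mk⇔ (twinPair⇒C4 ∘ twinPair) [ C4⇒type2c false , C4⇒type2c true ] , structure ∘ twinPair⇒start ∘ twinPair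
  where
  open StarGraph ddg hq
  open Component comp
  twinPair : (Σ (Vtx n) λ x → Σ (Vtx n) λ y → D x ≡ true × D y ≡ true × Type2c adj x y) → TwinPair
  twinPair (_ , _ , Dx , Dy , xy) = type2c⇒twinPair Dx Dy xy
  structure : (Σ (Fin n) λ a₀ → HasTwin (V₁ , a₀) × D (V₁ , a₀) ≡ true) →
    IsUnionOfC4 G* (Half false) × IsUnionOfC4 G* (Half true) × IsAlternatingLex adj D
  structure (a₀ , twin₀ , D₀) = union-of-C4 false , union-of-C4 true , alternating-lex
    where
    open Cycle a₀ twin₀
    open Spanning D comp D₀
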